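{- Let $x$ be an element of a nominal set, let $\bar c=c_1,\ldots,c_n$ be a list of $\mathsf{N}$-quantified names, and let $\pi$ be a permutation written as a product of disjoint cycles whose atoms may include the names $\bar c$ (so that $\pi$, $\pi_{\bar c}$ and $\pi_{\neg\bar c}$ are determined by each choice of distinct atoms for $\bar c$ distinct from the other atoms of $\pi$). Then: 1. $\mathsf{N}\bar c.\,\pi\cdot x=x$ holds iff both $\mathsf{N}\bar c.\,\pi_{\bar c}\cdot x=x$ and $\mathsf{N}\bar c.\,\pi_{\neg\bar c}\cdot x=x$ hold. 2. $\mathsf{N}\bar c.\,\pi_{\bar c}\cdot x=x$ holds iff for all $\bar c$, $\bar c\cap\mathrm{supp}(x)=\emptyset$ implies $\mathrm{dom}(\pi_{\bar c})\cap\mathrm{supp}(x)=\emptyset$. 3. $\mathsf{N}\bar c.\,\pi_{\neg\bar c}\cdot x=x$ holds iff for all $\bar c$, $\bar c\cap\mathrm{supp}(x)=\emptyset$ implies $\pi_{\neg\bar c}\cdot x=x$.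
   Context: Fix a countably infinite set $\mathbb{A}$ of atoms; finite permutations $\pi$ of $\mathbb{A}$ have finite $\mathrm{dom}(\pi)=\{a\mid\pi(a)\neq a\}$. A nominal set is a set with an action of the group of finite permutations such that every element $x$ has a finite support (a finite $B\subseteq\mathbb{A}$ such that every permutation fixing $B$ pointwise fixes $x$); $\mathrm{supp}(x)$ is the least finite support. The "new" quantifier: for a property $\phi$ of atoms, $\mathsf{N}a.\phi(a)$ holds iff $\{a\in\mathbb{A}\mid\phi(a)\text{ holds}\}$ is cofinite; for a list $\bar c=c_1,\ldots,c_n$, $\mathsf{N}\bar c.\phi(\bar c)$ abbreviates $\mathsf{N}c_1.\mathsf{N}c_2.\cdots\mathsf{N}c_n.\phi(\bar c)$. For a permutation $\pi$ written as a product of disjoint cycles and a finite set of names $\bar c$, $\pi_{\bar c}$ is the product of the disjoint cycles of $\pi$ that mention at least one atom of $\bar c$ (and $\pi_{\bar c}=\mathrm{id}$ if $\bar c\cap\mathrm{dom}(\pi)=\emptyset$), and $\pi_{\neg\bar c}$ is the product of the disjoint cycles of $\pi$ that mention no atom of $\bar c$ (and $\mathrm{id}$ if there are none); thus $\pi=\pi_{\bar c}\circ\pi_{\neg\bar c}$. -}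

module Defs where

open import Data.Nat using (ℕ; _≟_)
open import Data.Fin using (Fin; zero; suc)
open import Data.List using (List; []; _∷_; _++_; map; concat)
open import Data.List.Membership.Propositional using (_∈_; _∉_)
open import Data.List.Membership.Propositional.Properties using (∈-++⁺ˡ; ∈-++⁺ʳ)
open import Data.List.Relation.Unary.Unique.Propositional using (Unique)
open import Data.Sum using (_⊎_; inj₁; inj₂)
open import Data.Product using (Σ; ∃; _×_; _,_)
open import Data.Empty using (⊥-elim)
open import Data.List.Relation.Unary.Any using (here; there)
open import Data.Bool using (Bool; true; false; _∨_)
open import Relation.Nullary using (¬_; yes; no)
open import Relation.Binary.PropositionalEquality using (_≡_; _≢_; refl; sym; trans; cong)

Atom : Set
Atom = ℕ

record FinPerm : Set where
  field
    to      : Atom → Atom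
    from    : Atom → Atom
    to-from : ∀ a → to (from a) ≡ a
    from-to : ∀ a → from (to a) ≡ a
    bound   : List Atom
    outside : ∀ a → a ∉ bound → to a ≡ a
open FinPerm public

InDom : FinPerm → Atom → Set
InDom π a = to π a ≢ a

idP : FinPerm
idP = record { to = λ a → a ; from = λ a → a ; to-from = λ _ → refl
             ; from-to = λ _ → refl ; bound = [] ; outside = λ _ _ → refl }

_∘P_ : FinPerm → FinPerm → FinPerm
π ∘P σ = record
  { to = λ a → to π (to σ a)
  ; from = λ a → from σ (from π a)
  ; to-from = λ a → trans (cong (to π) (to-from σ (from π a))) (to-from π a)
  ; from-to = λ a → trans (cong (from σ) (from-to π (to σ a))) (from-to σ a)
  ; bound = bound π ++ bound σ
  ; outside = λ a a∉ →
      trans (cong (to π) (outside σ a (λ m → a∉ (∈-++⁺ʳ (bound π) m))))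
            (outside π a (λ m → a∉ (∈-++⁺ˡ m)))
  }

swapFun : Atom → Atom → Atom → Atom
swapFun a b c with c ≟ a
... | yes _ = b
... | no _ with c ≟ b
...   | yes _ = a
...   | no _ = c

private
  swap-a : ∀ a b → swapFun a b a ≡ b
  swap-a a b with a ≟ a
  ... | yes _ = refl
  ... | no ne = ⊥-elim (ne refl)

  swap-b : ∀ a b → swapFun a b b ≡ a
  swap-b a b with b ≟ a
  ... | yes eq = eq
  ... | no _ with b ≟ b
  ...   | yes _ = refl
  ...   | no ne = ⊥-elim (ne refl)

  swap-invol : ∀ a b c → swapFun a b (swapFun a b c) ≡ c
  swap-invol a b c with c ≟ a
  ... | yes refl = swap-b c b
  ... | no c≢a with c ≟ b
  ...   | yes refl = swap-a a c
  ...   | no c≢b with c ≟ a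
  ...     | yes eq = ⊥-elim (c≢a eq)
  ...     | no _ with c ≟ b
  ...       | yes eq = ⊥-elim (c≢b eq)
  ...       | no _ = refl

  swap-out : ∀ a b c → c ∉ (a ∷ b ∷ []) → swapFun a b c ≡ c
  swap-out a b c c∉ with c ≟ a
  ... | yes refl = ⊥-elim (c∉ (here refl))
  ... | no _ with c ≟ b
  ...   | yes refl = ⊥-elim (c∉ (there (here refl)))
  ...   | no _ = refl

swapP : Atom → Atom → FinPerm
swapP a b = record
  { to = swapFun a b ; from = swapFun a b
  ; to-from = swap-invol a b ; from-to = swap-invol a b
  ; bound = a ∷ b ∷ [] ; outside = swap-out a b }

-- The cycle (a₁ a₂ … a_k), mapping a_i ↦ a_{i+1} and a_k ↦ a₁,
-- built as (a₁ a_k) ∘ … ∘ (a₁ a₃) ∘ (a₁ a₂).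
cycleP : List Atom → FinPerm
cycleP [] = idP
cycleP (a ∷ as) = go as
  where
  go : List Atom → FinPerm
  go [] = idP
  go (b ∷ bs) = go bs ∘P swapP a b

productP : List (List Atom) → FinPerm
productP [] = idP
productP (c ∷ cs) = cycleP c ∘P productP cs

Supports : {X : Set} → (FinPerm → X → X) → List Atom → X → Set
Supports act B x = ∀ π → (∀ a → a ∈ B → to π a ≡ a) → act π x ≡ x

record NominalSet : Set₁ where
  field
    Carrier  : Set
    act      : FinPerm → Carrier → Carrier
    act-id   : ∀ x → act idP x ≡ x
    act-comp : ∀ π σ x → act (π ∘P σ) x ≡ act π (act σ x)
    act-ext  : ∀ π σ → (∀ a → to π a ≡ to σ a) → ∀ x → act π x ≡ act σ x
    finSupp  : ∀ x → Σ (List Atom) (λ B → Supports act B x)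
open NominalSet public

IsSupp : (X : NominalSet) → Carrier X → List Atom → Set
IsSupp X x S = Supports (act X) S x
             × (∀ B → Supports (act X) B x → ∀ a → a ∈ S → a ∈ B)

И : (Atom → Set) → Set
И φ = Σ (List Atom) (λ L → ∀ a → a ∉ L → φ a)

_∷ᵥ_ : {n : ℕ} → Atom → (Fin n → Atom) → (Fin (Data.Nat.suc n) → Atom)
(a ∷ᵥ ρ) zero = a
(a ∷ᵥ ρ) (suc i) = ρ i

-- Иc̄.φ(c̄) = Иc₁.Иc₂.⋯Иcₙ.φ(c̄); an assignment c̄ is a map Fin n → 𝔸
Иⁿ : (n : ℕ) → ((Fin n → Atom) → Set) → Set
Иⁿ ℕ.zero φ = φ (λ ())
Иⁿ (ℕ.suc n) φ = И (λ a → Иⁿ n (λ ρ → φ (a ∷ᵥ ρ)))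

-- Permutation templates: products of cycles whose entries are either
-- concrete atoms (inj₁) or one of the names c₁…cₙ (inj₂).

Entry : ℕ → Set
Entry n = Atom ⊎ Fin n

Template : ℕ → Set
Template n = List (List (Entry n))

-- "written as a product of disjoint cycles": no entry occurs twice
WellFormed : {n : ℕ} → Template n → Set
WellFormed t = Unique (concat t)

Admissible : {n : ℕ} → Template n → (Fin n → Atom) → Set
Admissible t ρ = (∀ i j → ρ i ≡ ρ j → i ≡ j) × (∀ i → inj₁ (ρ i) ∉ concat t)

inst : {n : ℕ} → (Fin n → Atom) → Entry n → Atom
inst ρ (inj₁ a) = a
inst ρ (inj₂ i) = ρ i

mentionsName : {n : ℕ} → List (Entry n) → Bool
mentionsName [] = false
mentionsName (inj₁ _ ∷ es) = mentionsName es
mentionsName (inj₂ _ ∷ es) = true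

nameCycles : {n : ℕ} → Template n → Template n
nameCycles [] = []
nameCycles (c ∷ cs) with mentionsName c
... | true = c ∷ nameCycles cs
... | false = nameCycles cs

otherCycles : {n : ℕ} → Template n → Template n
otherCycles [] = []
otherCycles (c ∷ cs) with mentionsName c
... | true = otherCycles cs
... | false = c ∷ otherCycles cs

permOf : {n : ℕ} → Template n → (Fin n → Atom) → FinPerm
permOf t ρ = productP (map (map (inst ρ)) t)

perm-c : {n : ℕ} → Template n → (Fin n → Atom) → FinPerm
perm-c t ρ = permOf (nameCycles t) ρ

perm-¬c : {n : ℕ} → Template n → (Fin n → Atom) → FinPerm
perm-¬c t ρ = permOf (otherCycles t) ρ

{-# OPTIONS --safe #-}
-- If π·x = x then π maps atoms outside supp(x) to atoms outside supp(x),
-- because supp(π·x) = π·supp(x). So when some cᵢ ∉ supp(x), the whole cycle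
-- of π through cᵢ avoids supp(x); for c̄ fresh for supp(x) this makes π_c̄ fix
-- supp(x) pointwise, hence π_c̄·x = x, and π_¬c̄·x = x follows from
-- π = π_c̄ ∘ π_¬c̄ (disjoint cycles commute). The concrete atoms of a name
-- cycle do not depend on c̄, and π_¬c̄ does not depend on c̄ at all, so what
-- holds for one fresh c̄ holds for every c̄ that avoids supp(x).
module Submission where

open import Defs
open import Data.Nat using (ℕ; zero; suc; _≟_)
open import Data.Nat.Properties using (≟-diag; 1+n≰n)
open import Data.Fin using (Fin; zero; suc)
open import Data.Bool using (true; false)
open import Data.List using (List; []; _∷_; _++_; [_]; map; concat)
open import Data.List.Properties using (∷-injective; map-cong-local; concat-map)
open import Data.List.Extrema.Nat using (max; xs≤max)
open import Data.List.Membership.Propositional using (_∈_; _∉_)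
open import Data.List.Membership.Propositional.Properties using (∈-map⁺; ∈-map⁻; ∈-concat⁺′; ∈-concat⁻′; ∈-++⁺ˡ; ∈-++⁺ʳ)
open import Data.List.Membership.DecPropositional _≟_ using (_∈?_)
open import Data.List.Relation.Binary.Disjoint.Propositional using (Disjoint)
open import Data.List.Relation.Binary.Subset.Propositional using (_⊆_)
open import Data.List.Relation.Binary.Subset.Propositional.Properties using (xs⊆xs++ys; xs⊆ys++xs; concat⁺) renaming (map⁺ to ⊆-map⁺)
open import Data.List.Relation.Unary.All as All using (All; []; _∷_)
open import Data.List.Relation.Unary.All.Properties using (++⁻ˡ; ++⁻ʳ) renaming (map⁺ to All-map⁺; map⁻ to All-map⁻)
open import Data.List.Relation.Unary.AllPairs using ([]; _∷_)
open import Data.List.Relation.Unary.Any using (here; there)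
open import Data.List.Relation.Unary.Unique.Propositional using (Unique)
open import Data.List.Relation.Unary.Unique.Propositional.Properties using (++⁺)
open import Data.Product using (∃; _×_; _,_; proj₁; proj₂)
open import Data.Sum using (inj₁; inj₂)
open import Data.Empty using (⊥-elim)
open import Function.Base using (_∘_)
open import Function.Bundles using (_⇔_; mk⇔)
open import Relation.Nullary using (¬_; yes; no)
open import Relation.Nullary.Decidable using (decidable-stable)
open import Relation.Binary.PropositionalEquality hiding ([_])

Unique-++⁻ : {A : Set} (xs : List A) {ys : List A} → Unique (xs ++ ys) →
  Unique xs × Unique ys × Disjoint xs ys
Unique-++⁻ [] u = [] , u , λ ()
Unique-++⁻ (x ∷ xs) (x∉ ∷ u) with Unique-++⁻ xs u
... | u-xs , u-ys , xs#ys = ++⁻ˡ xs x∉ ∷ u-xs , u-ys , λ where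
  (here refl , v∈ys) → All.lookup (++⁻ʳ xs x∉) v∈ys refl
  (there v∈xs , v∈ys) → xs#ys (v∈xs , v∈ys)

Unique-concat⁻ : {A : Set} {xss : List (List A)} {xs : List A} →
  Unique (concat xss) → xs ∈ xss → Unique xs
Unique-concat⁻ {xss = xs ∷ _} u (here refl) = proj₁ (Unique-++⁻ xs u)
Unique-concat⁻ {xss = ys ∷ _} u (there xs∈) = Unique-concat⁻ (proj₁ (proj₂ (Unique-++⁻ ys u))) xs∈

Unique-map⁺-injectiveOn : {A B : Set} {f : A → B} {xs : List A} →
  (∀ {x y} → x ∈ xs → y ∈ xs → f x ≡ f y → x ≡ y) → Unique xs → Unique (map f xs)
Unique-map⁺-injectiveOn inj [] = []
Unique-map⁺-injectiveOn inj (x∉ ∷ u) =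
  All-map⁺ (All.tabulate λ y∈ fx≡fy → All.lookup x∉ y∈ (inj (here refl) (there y∈) fx≡fy))
  ∷ Unique-map⁺-injectiveOn (λ x∈ y∈ → inj (there x∈) (there y∈)) u

rotation-orbit : {A : Set} {f : A → A} {Q : A → Set} → (∀ {y} → Q y → Q (f y)) →
  ∀ {x y} xs → map f (x ∷ xs) ≡ xs ++ [ x ] → y ∈ x ∷ xs → Q y → All Q (x ∷ xs)
rotation-orbit {f = f} {Q} closed xs rot y∈ qy = forward xs rot (reach-last xs rot y∈ qy)
  where
  forward : ∀ {x z} xs → map f (x ∷ xs) ≡ xs ++ [ z ] → Q x → All Q (x ∷ xs)
  forward [] _ qx = qx ∷ []
  forward (w ∷ xs) eq qx with ∷-injective eq
  ... | refl , eq′ = qx ∷ forward xs eq′ (closed qx)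

  reach-last : ∀ {x y z} xs → map f (x ∷ xs) ≡ xs ++ [ z ] → y ∈ x ∷ xs → Q y → Q z
  reach-last [] eq (here refl) qy with ∷-injective eq
  ... | refl , _ = closed qy
  reach-last (w ∷ xs) eq (here refl) qy with ∷-injective eq
  ... | refl , eq′ = reach-last xs eq′ (here refl) (closed qy)
  reach-last (w ∷ xs) eq (there y∈) qy = reach-last xs (proj₂ (∷-injective eq)) y∈ qy

to-injective : (π : FinPerm) {a b : Atom} → to π a ≡ to π b → a ≡ b
to-injective π {a} {b} eq = trans (sym (from-to π a)) (trans (cong (from π) eq) (from-to π b))

record SupportedIn (A : List Atom) (π : FinPerm) : Set where
  field
    maps-into     : ∀ {a} → a ∈ A → to π a ∈ A
    fixes-outside : ∀ {a} → a ∉ A → to π a ≡ a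
open SupportedIn

idP-supportedIn : (A : List Atom) → SupportedIn A idP
idP-supportedIn A = record { maps-into = λ a∈ → a∈ ; fixes-outside = λ _ → refl }

∘P-supportedIn : ∀ {A π σ} → SupportedIn A π → SupportedIn A σ → SupportedIn A (π ∘P σ)
∘P-supportedIn {π = π} π-in σ-in = record
  { maps-into     = maps-into π-in ∘ maps-into σ-in
  ; fixes-outside = λ a∉ → trans (cong (to π) (fixes-outside σ-in a∉)) (fixes-outside π-in a∉)
  }

supportedIn-⊆ : ∀ {A B π} → A ⊆ B → SupportedIn A π → SupportedIn B π
supportedIn-⊆ {A} {B} {π} A⊆B π-in = record
  { maps-into     = into
  ; fixes-outside = λ a∉B → fixes-outside π-in (a∉B ∘ A⊆B)
  }
  where
  into : ∀ {a} → a ∈ B → to π a ∈ B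
  into {a} a∈B with a ∈? A
  ... | yes a∈A = A⊆B (maps-into π-in a∈A)
  ... | no a∉A = subst (_∈ B) (sym (fixes-outside π-in a∉A)) a∈B

swapFun-left : ∀ a b → swapFun a b a ≡ b
swapFun-left a b rewrite ≟-diag (refl {x = a}) = refl

swapFun-right : ∀ a b → swapFun a b b ≡ a
swapFun-right a b with b ≟ a
... | yes b≡a = b≡a
... | no _ rewrite ≟-diag (refl {x = b}) = refl

swapFun-other : ∀ {a b c} → a ≢ c → b ≢ c → swapFun a b c ≡ c
swapFun-other {a} {b} {c} a≢c b≢c = outside (swapP a b) c λ where
  (here c≡a) → a≢c (sym c≡a)
  (there (here c≡b)) → b≢c (sym c≡b)

swapP-supportedIn : ∀ a b → SupportedIn (a ∷ b ∷ []) (swapP a b)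
swapP-supportedIn a b = record { maps-into = into ; fixes-outside = outside (swapP a b) _ }
  where
  into : ∀ {c} → c ∈ a ∷ b ∷ [] → swapFun a b c ∈ a ∷ b ∷ []
  into (here refl) = there (here (swapFun-left a b))
  into (there (here refl)) = here (swapFun-right a b)

cycleP-supportedIn : ∀ C → SupportedIn C (cycleP C)
cycleP-supportedIn [] = idP-supportedIn []
cycleP-supportedIn (a ∷ bs) = cycle-from bs
  where
  cycle-from : ∀ bs → SupportedIn (a ∷ bs) (cycleP (a ∷ bs))
  cycle-from [] = idP-supportedIn _
  cycle-from (b ∷ bs) =
    ∘P-supportedIn (supportedIn-⊆ skip-b (cycle-from bs)) (supportedIn-⊆ first-two (swapP-supportedIn a b))
    where
    skip-b : a ∷ bs ⊆ a ∷ b ∷ bs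
    skip-b (here refl) = here refl
    skip-b (there c∈) = there (there c∈)
    first-two : a ∷ b ∷ [] ⊆ a ∷ b ∷ bs
    first-two (here refl) = here refl
    first-two (there (here refl)) = there (here refl)

productP-supportedIn : ∀ cs → SupportedIn (concat cs) (productP cs)
productP-supportedIn [] = idP-supportedIn []
productP-supportedIn (C ∷ cs) =
  ∘P-supportedIn (supportedIn-⊆ (xs⊆xs++ys C (concat cs)) (cycleP-supportedIn C))
                 (supportedIn-⊆ (xs⊆ys++xs (concat cs) C) (productP-supportedIn cs))

supportedIn-commute-∈ : ∀ {A B π σ} → SupportedIn A π → SupportedIn B σ → Disjoint A B →
  ∀ {a} → a ∈ A → to π (to σ a) ≡ to σ (to π a)
supportedIn-commute-∈ {π = π} π-in σ-in A#B a∈A =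
  trans (cong (to π) (fixes-outside σ-in (λ a∈B → A#B (a∈A , a∈B))))
        (sym (fixes-outside σ-in (λ πa∈B → A#B (maps-into π-in a∈A , πa∈B))))

supportedIn-commute : ∀ {A B π σ} → SupportedIn A π → SupportedIn B σ → Disjoint A B →
  ∀ a → to π (to σ a) ≡ to σ (to π a)
supportedIn-commute {A} {B} {π} {σ} π-in σ-in A#B a with a ∈? A | a ∈? B
... | yes a∈A | _ = supportedIn-commute-∈ π-in σ-in A#B a∈A
... | no _ | yes a∈B = sym (supportedIn-commute-∈ σ-in π-in (λ (v∈B , v∈A) → A#B (v∈A , v∈B)) a∈B)
... | no a∉A | no a∉B = begin
  to π (to σ a) ≡⟨ cong (to π) (fixes-outside σ-in a∉B) ⟩
  to π a        ≡⟨ fixes-outside π-in a∉A ⟩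
  a             ≡⟨ sym (fixes-outside σ-in a∉B) ⟩
  to σ a        ≡⟨ cong (to σ) (sym (fixes-outside π-in a∉A)) ⟩
  to σ (to π a) ∎
  where open ≡-Reasoning

cycleP-rotates : ∀ a bs → Unique (a ∷ bs) → map (to (cycleP (a ∷ bs))) (a ∷ bs) ≡ bs ++ [ a ]
cycleP-rotates a [] _ = refl
cycleP-rotates a (b ∷ bs) ((a≢b ∷ a∉bs) ∷ b∉bs ∷ u) = begin
  g (s a) ∷ g (s b) ∷ map (g ∘ s) bs ≡⟨ cong₂ _∷_ (cong g (swapFun-left a b))
                                          (cong₂ _∷_ (cong g (swapFun-right a b)) s-fixes-bs) ⟩
  g b ∷ g a ∷ map g bs               ≡⟨ cong₂ _∷_ g-fixes-b (cycleP-rotates a bs (a∉bs ∷ u)) ⟩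
  b ∷ bs ++ [ a ]                    ∎
  where
  open ≡-Reasoning
  g s : Atom → Atom
  g = to (cycleP (a ∷ bs))
  s = swapFun a b
  g-fixes-b : g b ≡ b
  g-fixes-b = fixes-outside (cycleP-supportedIn (a ∷ bs)) λ where
    (here b≡a) → a≢b (sym b≡a)
    (there b∈bs) → All.lookup b∉bs b∈bs refl
  s-fixes-bs : map (g ∘ s) bs ≡ map g bs
  s-fixes-bs = map-cong-local (All.tabulate λ y∈ →
    cong g (swapFun-other (All.lookup a∉bs y∈) (All.lookup b∉bs y∈)))

productP-agrees : ∀ {cs C a} → Unique (concat cs) → C ∈ cs → a ∈ C →
  to (productP cs) a ≡ to (cycleP C) a
productP-agrees {C ∷ cs} u (here refl) a∈C with Unique-++⁻ C u
... | _ , _ , C#cs = cong (to (cycleP C)) (fixes-outside (productP-supportedIn cs) λ a∈cs → C#cs (a∈C , a∈cs))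
productP-agrees {D ∷ cs} {C} u (there C∈cs) a∈C with Unique-++⁻ D u
... | _ , u-cs , D#cs = trans (cong (to (cycleP D)) (productP-agrees u-cs C∈cs a∈C))
  (fixes-outside (cycleP-supportedIn D) λ γa∈D →
    D#cs (γa∈D , ∈-concat⁺′ (maps-into (cycleP-supportedIn C) a∈C) C∈cs))

productP-orbit : ∀ {cs C y} {Q : Atom → Set} → Unique (concat cs) →
  (∀ {z} → Q z → Q (to (productP cs) z)) → C ∈ cs → y ∈ C → Q y → All Q C
productP-orbit {C = []} _ _ _ ()
productP-orbit {cs} {a ∷ bs} u closed C∈cs = rotation-orbit closed bs rotates
  where
  rotates : map (to (productP cs)) (a ∷ bs) ≡ bs ++ [ a ]
  rotates = trans (map-cong-local (All.tabulate (productP-agrees u C∈cs)))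
                  (cycleP-rotates a bs (Unique-concat⁻ u C∈cs))

instantiate : {n : ℕ} → (Fin n → Atom) → Template n → List (List Atom)
instantiate c t = map (map (inst c)) t

atoms : {n : ℕ} → List (Entry n) → List Atom
atoms [] = []
atoms (inj₁ a ∷ es) = a ∷ atoms es
atoms (inj₂ _ ∷ es) = atoms es

∈-atoms⁺ : ∀ {n} {a} (es : List (Entry n)) → inj₁ a ∈ es → a ∈ atoms es
∈-atoms⁺ (inj₁ _ ∷ es) (here refl) = here refl
∈-atoms⁺ (inj₁ _ ∷ es) (there a∈) = there (∈-atoms⁺ es a∈)
∈-atoms⁺ (inj₂ _ ∷ es) (there a∈) = ∈-atoms⁺ es a∈

inst-injectiveOn : ∀ {n} {t : Template n} {c} → Admissible t c →
  ∀ {e f} → e ∈ concat t → f ∈ concat t → inst c e ≡ inst c f → e ≡ f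
inst-injectiveOn _ {inj₁ _} {inj₁ _} _ _ refl = refl
inst-injectiveOn (c-injective , _) {inj₂ i} {inj₂ j} _ _ eq = cong inj₂ (c-injective i j eq)
inst-injectiveOn (_ , c-fresh) {inj₁ _} {inj₂ j} a∈ _ refl = ⊥-elim (c-fresh j a∈)
inst-injectiveOn (_ , c-fresh) {inj₂ i} {inj₁ _} _ b∈ refl = ⊥-elim (c-fresh i b∈)

instantiate-unique : ∀ {n} (t : Template n) {c} → WellFormed t → Admissible t c →
  Unique (concat (instantiate c t))
instantiate-unique t wf adm =
  subst Unique (sym (concat-map t)) (Unique-map⁺-injectiveOn (inst-injectiveOn {t = t} adm) wf)

mentionsName⇒name : ∀ {n} (C : List (Entry n)) → mentionsName C ≡ true → ∃ λ i → inj₂ i ∈ C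
mentionsName⇒name (inj₁ _ ∷ C) named with mentionsName⇒name C named
... | i , i∈C = i , there i∈C
mentionsName⇒name (inj₂ i ∷ C) _ = i , here refl

∈-nameCycles⁻ : ∀ {n} (t : Template n) {C} → C ∈ nameCycles t → C ∈ t × mentionsName C ≡ true
∈-nameCycles⁻ (D ∷ t) C∈ with mentionsName D in named
∈-nameCycles⁻ (D ∷ t) (here refl) | true = here refl , named
∈-nameCycles⁻ (D ∷ t) (there C∈) | true with ∈-nameCycles⁻ t C∈
... | C∈t , C-named = there C∈t , C-named
∈-nameCycles⁻ (D ∷ t) C∈ | false with ∈-nameCycles⁻ t C∈
... | C∈t , C-named = there C∈t , C-named

nameCycles-⊆ : ∀ {n} (t : Template n) → nameCycles t ⊆ t
nameCycles-⊆ t = proj₁ ∘ ∈-nameCycles⁻ t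

nameCycles-wellFormed : ∀ {n} (t : Template n) → WellFormed t → WellFormed (nameCycles t)
nameCycles-wellFormed [] wf = wf
nameCycles-wellFormed (C ∷ t) wf with mentionsName C | Unique-++⁻ C wf
... | true | u-C , wf-t , C#t = ++⁺ u-C (nameCycles-wellFormed t wf-t)
  λ (e∈C , e∈nc) → C#t (e∈C , concat⁺ (nameCycles-⊆ t) e∈nc)
... | false | _ , wf-t , _ = nameCycles-wellFormed t wf-t

nameCycles-admissible : ∀ {n} (t : Template n) {c} → Admissible t c → Admissible (nameCycles t) c
nameCycles-admissible t (c-injective , c-fresh) =
  c-injective , λ i c∈ → c-fresh i (concat⁺ (nameCycles-⊆ t) c∈)

perm-¬c-independent : ∀ {n} (t : Template n) c d → perm-¬c t c ≡ perm-¬c t d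
perm-¬c-independent t c d = cong productP (instantiate-otherCycles t)
  where
  instantiate-unnamed : ∀ C → mentionsName C ≡ false → map (inst c) C ≡ map (inst d) C
  instantiate-unnamed [] _ = refl
  instantiate-unnamed (inj₁ a ∷ C) unnamed = cong (a ∷_) (instantiate-unnamed C unnamed)
  instantiate-otherCycles : ∀ t → instantiate c (otherCycles t) ≡ instantiate d (otherCycles t)
  instantiate-otherCycles [] = refl
  instantiate-otherCycles (C ∷ t) with mentionsName C in unnamed
  ... | true = instantiate-otherCycles t
  ... | false = cong₂ _∷_ (instantiate-unnamed C unnamed) (instantiate-otherCycles t)

permOf-split : ∀ {n} (t : Template n) c → Unique (concat (instantiate c t)) →
  ∀ a → to (permOf t c) a ≡ to (perm-c t c) (to (perm-¬c t c) a)
permOf-split [] c u a = refl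
permOf-split (C ∷ t) c u a with mentionsName C | Unique-++⁻ (map (inst c) C) u
... | true | _ , u-t , _ = cong (to (cycleP (map (inst c) C))) (permOf-split t c u-t a)
... | false | _ , u-t , C#t = begin
  to γ (to (permOf t c) a)                    ≡⟨ cong (to γ) (permOf-split t c u-t a) ⟩
  to γ (to (perm-c t c) (to (perm-¬c t c) a)) ≡⟨ supportedIn-commute (cycleP-supportedIn _)
                                                   (productP-supportedIn (instantiate c (nameCycles t))) C#nc _ ⟩
  to (perm-c t c) (to γ (to (perm-¬c t c) a)) ∎
  where
  open ≡-Reasoning
  γ : FinPerm
  γ = cycleP (map (inst c) C)
  C#nc : Disjoint (map (inst c) C) (concat (instantiate c (nameCycles t)))
  C#nc (e∈C , e∈nc) = C#t (e∈C , concat⁺ (⊆-map⁺ (map (inst c)) (nameCycles-⊆ t)) e∈nc)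

namedCycle-closed : ∀ {n} {t : Template n} {c} {Q : Atom → Set} →
  Unique (concat (instantiate c t)) → (∀ {y} → Q y → Q (to (permOf t c) y)) → (∀ i → Q (c i)) →
  ∀ {C} → C ∈ t → mentionsName C ≡ true → All Q (map (inst c) C)
namedCycle-closed {c = c} u closed Q-c {C} C∈t named with mentionsName⇒name C named
... | i , i∈C = productP-orbit u closed (∈-map⁺ (map (inst c)) C∈t) (∈-map⁺ (inst c) i∈C) (Q-c i)

invP : FinPerm → FinPerm
invP π = record
  { to = from π ; from = to π ; to-from = from-to π ; from-to = to-from π
  ; bound = bound π
  ; outside = λ a a∉ → trans (cong (from π) (sym (outside π a a∉))) (from-to π a)
  }

module _ (X : NominalSet) where

  act-invP-left : ∀ π y → act X (invP π) (act X π y) ≡ y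
  act-invP-left π y = trans (sym (act-comp X (invP π) π y))
    (trans (act-ext X (invP π ∘P π) idP (from-to π) y) (act-id X y))

  act-invP-right : ∀ π y → act X π (act X (invP π) y) ≡ y
  act-invP-right π y = trans (sym (act-comp X π (invP π) y))
    (trans (act-ext X (π ∘P invP π) idP (to-from π) y) (act-id X y))

  act-injective : ∀ π {y z} → act X π y ≡ act X π z → y ≡ z
  act-injective π {y} {z} eq = trans (sym (act-invP-left π y))
    (trans (cong (act X (invP π)) eq) (act-invP-left π z))

  Supports-act : ∀ π {B x} → Supports (act X) B x → Supports (act X) (map (to π) B) (act X π x)
  Supports-act π {B} {x} B-supports σ σ-fixes = begin
    act X σ (act X π x)                             ≡⟨ sym (act-invP-right π _) ⟩
    act X π (act X (invP π) (act X σ (act X π x))) ≡⟨ cong (act X π) (sym conjugate-act) ⟩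
    act X π (act X (invP π ∘P (σ ∘P π)) x)         ≡⟨ cong (act X π) (B-supports _ conjugate-fixes) ⟩
    act X π x                                       ∎
    where
    open ≡-Reasoning
    conjugate-act : act X (invP π ∘P (σ ∘P π)) x ≡ act X (invP π) (act X σ (act X π x))
    conjugate-act = trans (act-comp X (invP π) (σ ∘P π) x) (cong (act X (invP π)) (act-comp X σ π x))
    conjugate-fixes : ∀ a → a ∈ B → from π (to σ (to π a)) ≡ a
    conjugate-fixes a a∈B = trans (cong (from π) (σ-fixes (to π a) (∈-map⁺ (to π) a∈B))) (from-to π a)

  supp-∉-stable : ∀ {x S} → IsSupp X x S → ∀ π → act X π x ≡ x → ∀ {a} → a ∉ S → to π a ∉ S
  supp-∉-stable {x} {S} (S-supports , S-least) π πx≡x {a} a∉S πa∈S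
    with ∈-map⁻ (to π) (S-least _ πS-supports (to π a) πa∈S)
    where
    πS-supports : Supports (act X) (map (to π) S) x
    πS-supports = subst (Supports (act X) (map (to π) S)) πx≡x (Supports-act π S-supports)
  ... | s , s∈S , πa≡πs = a∉S (subst (_∈ S) (sym (to-injective π πa≡πs)) s∈S)

fresh : (L : List Atom) → ∃ (_∉ L)
fresh L = suc (max 0 L) , λ a∈L → 1+n≰n (All.lookup (xs≤max 0 L) a∈L)

Distinct : {n : ℕ} → (Fin n → Atom) → Set
Distinct c = ∀ i j → c i ≡ c j → i ≡ j

Иⁿ-map : ∀ n {φ ψ : (Fin n → Atom) → Set} → (∀ c → φ c → ψ c) → Иⁿ n φ → Иⁿ n ψ
Иⁿ-map zero f p = f _ p
Иⁿ-map (suc n) f (L , p) = L , λ a a∉L → Иⁿ-map n (λ ρ → f (a ∷ᵥ ρ)) (p a a∉L)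

Иⁿ-zip : ∀ n {φ ψ : (Fin n → Atom) → Set} → Иⁿ n φ → Иⁿ n ψ → Иⁿ n (λ c → φ c × ψ c)
Иⁿ-zip zero p q = p , q
Иⁿ-zip (suc n) (L , p) (M , q) =
  L ++ M , λ a a∉ → Иⁿ-zip n (p a (a∉ ∘ ∈-++⁺ˡ)) (q a (a∉ ∘ ∈-++⁺ʳ L))

Иⁿ-fresh : ∀ n (L : List Atom) → Иⁿ n (λ c → ∀ i → c i ∉ L)
Иⁿ-fresh zero L = λ ()
Иⁿ-fresh (suc n) L = L , λ a a∉L → Иⁿ-map n (λ ρ ρ∉L → λ { zero → a∉L ; (suc i) → ρ∉L i }) (Иⁿ-fresh n L)

Иⁿ-distinct : ∀ n → Иⁿ n Distinct
Иⁿ-distinct zero = λ ()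
Иⁿ-distinct (suc n) = [] , λ a _ → Иⁿ-map n ∷ᵥ-distinct (Иⁿ-zip n (Иⁿ-distinct n) (Иⁿ-fresh n (a ∷ [])))
  where
  ∷ᵥ-distinct : ∀ {a} ρ → Distinct ρ × (∀ i → ρ i ∉ a ∷ []) → Distinct (a ∷ᵥ ρ)
  ∷ᵥ-distinct ρ (ρ-distinct , ρ≢a) = λ where
    zero zero _ → refl
    zero (suc j) a≡ρj → ⊥-elim (ρ≢a j (here (sym a≡ρj)))
    (suc i) zero ρi≡a → ⊥-elim (ρ≢a i (here ρi≡a))
    (suc i) (suc j) ρi≡ρj → cong suc (ρ-distinct i j ρi≡ρj)

Иⁿ-intro : ∀ n {φ : (Fin n → Atom) → Set} (L : List Atom) → (∀ c → (∀ i → c i ∉ L) → φ c) → Иⁿ n φ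
Иⁿ-intro n L f = Иⁿ-map n f (Иⁿ-fresh n L)

Иⁿ-map-fresh : ∀ n {φ ψ : (Fin n → Atom) → Set} (L : List Atom) →
  (∀ c → (∀ i → c i ∉ L) → φ c → ψ c) → Иⁿ n φ → Иⁿ n ψ
Иⁿ-map-fresh n L f p = Иⁿ-map n (λ c (c∉L , q) → f c c∉L q) (Иⁿ-zip n (Иⁿ-fresh n L) p)

Иⁿ-witness : ∀ n {φ : (Fin n → Atom) → Set} → Иⁿ n φ → ∃ φ
Иⁿ-witness zero p = _ , p
Иⁿ-witness (suc n) (L , p) with fresh L
... | a , a∉L with Иⁿ-witness n (p a a∉L)
...   | ρ , q = a ∷ᵥ ρ , q

Иⁿ-admissible : ∀ n (t : Template n) → Иⁿ n (Admissible t)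
Иⁿ-admissible n t = Иⁿ-map n (λ c (c-distinct , c∉t) → c-distinct , λ i c∈t → c∉t i (∈-atoms⁺ (concat t) c∈t))
  (Иⁿ-zip n (Иⁿ-distinct n) (Иⁿ-fresh n (atoms (concat t))))

Иⁿ-admissible-witness : ∀ n (t : Template n) (L : List Atom) {φ : (Fin n → Atom) → Set} →
  Иⁿ n (λ c → Admissible t c → φ c) → ∃ λ c → Admissible t c × (∀ i → c i ∉ L) × φ c
Иⁿ-admissible-witness n t L p with Иⁿ-witness n (Иⁿ-zip n (Иⁿ-zip n (Иⁿ-admissible n t) (Иⁿ-fresh n L)) p)
... | c , (adm , c∉L) , q = c , adm , c∉L , q adm

module _ (X : NominalSet) {n : ℕ} (t : Template n) (wf : WellFormed t) {c : Fin n → Atom} (adm : Admissible t c) where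

  act-permOf-split : ∀ y → act X (permOf t c) y ≡ act X (perm-c t c) (act X (perm-¬c t c) y)
  act-permOf-split y = trans (act-ext X _ _ (permOf-split t c (instantiate-unique t wf adm)) y)
                             (act-comp X (perm-c t c) (perm-¬c t c) y)

  permOf-fixes : ∀ {y} → act X (perm-c t c) y ≡ y → act X (perm-¬c t c) y ≡ y → act X (permOf t c) y ≡ y
  permOf-fixes {y} c-fixes ¬c-fixes =
    trans (act-permOf-split y) (trans (cong (act X (perm-c t c)) ¬c-fixes) c-fixes)

module _ (X : NominalSet) {x : Carrier X} {S : List Atom} (x-supp : IsSupp X x S) where

  namedCycle-avoids-supp : ∀ {n} (t : Template n) {c} → WellFormed t → Admissible t c → (∀ i → c i ∉ S) →
    act X (permOf t c) x ≡ x → ∀ {C} → C ∈ t → mentionsName C ≡ true → All (_∉ S) (map (inst c) C)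
  namedCycle-avoids-supp t wf adm c∉S fixed =
    namedCycle-closed (instantiate-unique t wf adm) (supp-∉-stable X x-supp _ fixed) c∉S

  perm-c-fixes-supp : ∀ {n} (t : Template n) c → (∀ {C} → C ∈ nameCycles t → All (_∉ S) (map (inst c) C)) →
    ∀ a → a ∈ S → to (perm-c t c) a ≡ a
  perm-c-fixes-supp t c avoids a a∈S = fixes-outside (productP-supportedIn (instantiate c (nameCycles t))) a∉
    where
    a∉ : a ∉ concat (instantiate c (nameCycles t))
    a∉ a∈ with ∈-concat⁻′ (instantiate c (nameCycles t)) a∈
    ... | _ , a∈xs , xs∈ with ∈-map⁻ (map (inst c)) xs∈
    ...   | C , C∈ , refl = All.lookup (avoids C∈) a∈xs a∈S

  perm-c-fixes : ∀ {n} (t : Template n) {c} → WellFormed t → Admissible t c → (∀ i → c i ∉ S) →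
    act X (permOf t c) x ≡ x → act X (perm-c t c) x ≡ x
  perm-c-fixes t {c} wf adm c∉S fixed = proj₁ x-supp _ (perm-c-fixes-supp t c avoids)
    where
    avoids : ∀ {C} → C ∈ nameCycles t → All (_∉ S) (map (inst c) C)
    avoids C∈ with ∈-nameCycles⁻ t C∈
    ... | C∈t , named = namedCycle-avoids-supp t wf adm c∉S fixed C∈t named

  perm-¬c-fixes : ∀ {n} (t : Template n) {c} → WellFormed t → Admissible t c → (∀ i → c i ∉ S) →
    act X (permOf t c) x ≡ x → act X (perm-¬c t c) x ≡ x
  perm-¬c-fixes t {c} wf adm c∉S fixed = act-injective X (perm-c t c) (begin
    act X (perm-c t c) (act X (perm-¬c t c) x) ≡⟨ sym (act-permOf-split X t wf adm x) ⟩
    act X (permOf t c) x                      ≡⟨ fixed ⟩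
    x                                         ≡⟨ sym (perm-c-fixes t wf adm c∉S fixed) ⟩
    act X (perm-c t c) x                      ∎)
    where open ≡-Reasoning

  perm-c-fixes-supp-generic : ∀ {n} (t : Template n) {c₀} → WellFormed t → Admissible t c₀ → (∀ i → c₀ i ∉ S) →
    act X (perm-c t c₀) x ≡ x → ∀ c → (∀ i → c i ∉ S) → ∀ a → a ∈ S → to (perm-c t c) a ≡ a
  perm-c-fixes-supp-generic t {c₀} wf adm₀ c₀∉S fixed c c∉S = perm-c-fixes-supp t c avoids
    where
    reinstantiate : ∀ e → inst c₀ e ∉ S → inst c e ∉ S
    reinstantiate (inj₁ _) a∉S = a∉S
    reinstantiate (inj₂ i) _ = c∉S i
    avoids : ∀ {C} → C ∈ nameCycles t → All (_∉ S) (map (inst c) C)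
    avoids C∈ = All-map⁺ (All.map (λ {e} → reinstantiate e) (All-map⁻
      (namedCycle-avoids-supp (nameCycles t) (nameCycles-wellFormed t wf) (nameCycles-admissible t adm₀) c₀∉S fixed
                              C∈ (proj₂ (∈-nameCycles⁻ t C∈)))))

lemma2 : (X : NominalSet) (x : Carrier X) (S : List Atom) → IsSupp X x S →
    (n : ℕ) (t : Template n) → WellFormed t →
    (Иⁿ n (λ c → Admissible t c → act X (permOf t c) x ≡ x)
      ⇔ (Иⁿ n (λ c → Admissible t c → act X (perm-c t c) x ≡ x)
         × Иⁿ n (λ c → Admissible t c → act X (perm-¬c t c) x ≡ x)))
    × (Иⁿ n (λ c → Admissible t c → act X (perm-c t c) x ≡ x)
      ⇔ (∀ (c : Fin n → Atom) → Admissible t c → (∀ i → c i ∉ S) →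
           ∀ a → a ∈ S → ¬ InDom (perm-c t c) a))
    × (Иⁿ n (λ c → Admissible t c → act X (perm-¬c t c) x ≡ x)
      ⇔ (∀ (c : Fin n → Atom) → Admissible t c → (∀ i → c i ∉ S) →
           act X (perm-¬c t c) x ≡ x))
lemma2 X x S x-supp n t wf =
    mk⇔ (λ fixed → Иⁿ-map-fresh n S (λ _ c∉S h adm → perm-c-fixes X x-supp t wf adm c∉S (h adm)) fixed
                 , Иⁿ-map-fresh n S (λ _ c∉S h adm → perm-¬c-fixes X x-supp t wf adm c∉S (h adm)) fixed)
        (λ (c-fixed , ¬c-fixed) → Иⁿ-map n (λ _ (hc , h¬c) adm → permOf-fixes X t wf adm (hc adm) (h¬c adm))
                                           (Иⁿ-zip n c-fixed ¬c-fixed))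
  , mk⇔ (λ c-fixed c _ c∉S a a∈S moved →
           let (c₀ , adm₀ , c₀∉S , fixed) = Иⁿ-admissible-witness n t S c-fixed
           in moved (perm-c-fixes-supp-generic X x-supp t wf adm₀ c₀∉S fixed c c∉S a a∈S))
        (λ stays → Иⁿ-intro n S λ c c∉S adm →
           proj₁ x-supp _ λ a a∈S → decidable-stable (_ ≟ a) (stays c adm c∉S a a∈S))
  , mk⇔ (λ ¬c-fixed c _ _ →
           let (c₀ , _ , _ , fixed) = Иⁿ-admissible-witness n t S ¬c-fixed
           in trans (cong (λ π → act X π x) (perm-¬c-independent t c c₀)) fixed)
        (λ fixed → Иⁿ-intro n S λ c c∉S adm → fixed c adm c∉S)
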